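{- For every positive integer $n$, $$\frac{n^2(n^2-1)}{6}\ \Big|\ \sum_{k=0}^{n-1}k(k+1)(8k+9)T_kT_{k+1}.$$
   Context: For $n\in\mathbb{N}$, the central trinomial coefficient $T_n$ is the constant term of $(1+x+x^{ -1})^n$; equivalently $T_n=\sum_{k=0}^{\lfloor n/2\rfloor}\binom{n}{2k}\binom{2k}{k}$. Here $a\mid b$ means $b=ac$ for some integer $c$ (for $n=1$ the divisor is $0$ and the statement means the sum is $0$). -}

module Defs where

open import Data.Nat using (ℕ; zero; suc; _+_; _*_; _/_)
open import Data.Nat.Combinatorics using (_C_)

Σ< : ℕ → (ℕ → ℕ) → ℕ
Σ< zero    f = 0
Σ< (suc n) f = Σ< n f + f n

Σ≤ : ℕ → (ℕ → ℕ) → ℕ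
Σ≤ n f = Σ< (suc n) f

T : ℕ → ℕ
T n = Σ≤ (n / 2) (λ k → (n C (2 * k)) * ((2 * k) C k))

module Submission where

-- Write T n for the constant coefficient and E n for the coefficient of x in
-- (1 + x + x⁻¹)ⁿ; both are explicit binomial sums.  Pascal's rule and the
-- absorption identity (k+1)·C(n+1,k+1) = (n+1)·C(n,k) give the recurrences
--     T (n+1) = T n + 2·E n,        (n+2)·E (n+1) = (n+1)·(E n + 2·T n).
-- Over ℤ set u 0 = 0 and u (n+1) = E n + 2·T n − E (n+1); the second recurrence
-- says exactly that E n = n·u n, and (T, u) then obey first-order linear
-- recurrences.  With Δ n = n²(n²−1) and an explicit quadratic form Q, the sum
-- S n = Σ_{k<n} k(k+1)(8k+9)·T k·T (k+1) has the closed form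
--     6·S n = Δ n · Q (n, T n, u (n−1), u n)          (n ≥ 1),
-- proved by induction on n: the inductive step is a polynomial identity modulo
-- the linear recurrences, verified by the ring solver with explicit cofactors.
-- Since Δ n = 6·n·C(n+1,3), cancelling 6 exhibits S n as a multiple of
-- n·C(n+1,3) = n²(n²−1)/6.

module Binomial where
  open import Data.Nat using (ℕ; zero; suc; _+_; _*_)
  open import Data.Nat.Properties
    using (*-identityˡ; *-identityʳ; *-zeroʳ; *-assoc; +-comm; +-cancelˡ-≡; *-cancelˡ-≡)
  open import Data.Nat.Combinatorics using (_C_; nCk+nC[k+1]≡[n+1]C[k+1]; nC1≡n)
  open import Relation.Binary.PropositionalEquality using (_≡_; sym; cong; cong₂; module ≡-Reasoning)
  open import Data.Nat.Tactic.RingSolver using (solve-∀)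
  open ≡-Reasoning

  pascal : ∀ n k → suc n C suc k ≡ n C k + n C suc k
  pascal n k = sym (nCk+nC[k+1]≡[n+1]C[k+1] n k)

  absorption : ∀ n k → suc k * (suc n C suc k) ≡ suc n * (n C k)
  absorption n zero = begin
    1 * (suc n C 1) ≡⟨ *-identityˡ _ ⟩
    suc n C 1       ≡⟨ nC1≡n (suc n) ⟩
    suc n           ≡⟨ *-identityʳ (suc n) ⟨
    suc n * 1       ∎
  absorption zero (suc k) = *-zeroʳ (suc (suc k))
  absorption (suc n) (suc k) = begin
    suc (suc k) * (suc (suc n) C suc (suc k)) ≡⟨ cong (suc (suc k) *_) (pascal (suc n) (suc k)) ⟩
    suc (suc k) * (x + y)                     ≡⟨ split k x y ⟩
    suc k * x + x + suc (suc k) * y           ≡⟨ cong₂ (λ a b → a + x + b) (absorption n k) (absorption n (suc k)) ⟩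
    suc n * (n C k) + x + suc n * (n C suc k) ≡⟨ merge n (n C k) (n C suc k) x ⟩
    suc n * (n C k + n C suc k) + x           ≡⟨ cong (λ w → suc n * w + x) (pascal n k) ⟨
    suc n * x + x                             ≡⟨ +-comm (suc n * x) x ⟩
    suc (suc n) * x                           ∎
    where
    x = suc n C suc k
    y = suc n C suc (suc k)
    split : ∀ k x y → suc (suc k) * (x + y) ≡ suc k * x + x + suc (suc k) * y
    split = solve-∀
    merge : ∀ n a b x → suc n * a + x + suc n * b ≡ suc n * (a + b) + x
    merge = solve-∀

  -- Complementary absorption (n−k)·C(n,k) = (k+1)·C(n,k+1), without subtraction.
  absorption-complement : ∀ n k → n * (n C k) ≡ k * (n C k) + suc k * (n C suc k)
  absorption-complement n k = +-cancelˡ-≡ (n C k) _ _ (begin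
    suc n * (n C k)                             ≡⟨ absorption n k ⟨
    suc k * (suc n C suc k)                     ≡⟨ cong (suc k *_) (pascal n k) ⟩
    suc k * (n C k + n C suc k)                 ≡⟨ regroup k (n C k) (n C suc k) ⟩
    n C k + (k * (n C k) + suc k * (n C suc k)) ∎)
    where
    regroup : ∀ k x y → suc k * (x + y) ≡ x + (k * x + suc k * y)
    regroup = solve-∀

  central-ratio : ∀ k → suc k * (suc (2 * k) C k) ≡ suc (2 * k) * (2 * k C k)
  central-ratio k = +-cancelˡ-≡ (k * c) _ _ (begin
    k * c + suc k * c                     ≡⟨ split k c ⟩
    suc (2 * k) * c                       ≡⟨ absorption-complement (suc (2 * k)) k ⟩
    k * c + suc k * (suc (2 * k) C suc k) ≡⟨ cong (k * c +_) (absorption (2 * k) k) ⟩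
    k * c + suc (2 * k) * (2 * k C k)     ∎)
    where
    c = suc (2 * k) C k
    split : ∀ k c → k * c + suc k * c ≡ suc (2 * k) * c
    split = solve-∀

  central-double : ∀ k → suc (suc (2 * k)) C suc k ≡ 2 * (suc (2 * k) C k)
  central-double k = *-cancelˡ-≡ _ _ (suc k) (begin
    suc k * (suc (suc (2 * k)) C suc k)   ≡⟨ absorption (suc (2 * k)) k ⟩
    suc (suc (2 * k)) * (suc (2 * k) C k) ≡⟨ double k (suc (2 * k) C k) ⟩
    suc k * (2 * (suc (2 * k) C k))       ∎)
    where
    double : ∀ k c → suc (suc (2 * k)) * c ≡ suc k * (2 * c)
    double = solve-∀

  six-choose-three : ∀ m → 6 * (suc (suc m) C 3) ≡ suc (suc m) * (suc m * m)
  six-choose-three m = begin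
    6 * (suc (suc m) C 3)           ≡⟨ *-assoc 2 3 (suc (suc m) C 3) ⟩
    2 * (3 * (suc (suc m) C 3))     ≡⟨ cong (2 *_) (absorption (suc m) 2) ⟩
    2 * (suc (suc m) * (suc m C 2)) ≡⟨ swap (suc (suc m)) (suc m C 2) ⟩
    suc (suc m) * (2 * (suc m C 2)) ≡⟨ cong (suc (suc m) *_) (absorption m 1) ⟩
    suc (suc m) * (suc m * (m C 1)) ≡⟨ cong (λ x → suc (suc m) * (suc m * x)) (nC1≡n m) ⟩
    suc (suc m) * (suc m * m)       ∎
    where
    swap : ∀ a b → 2 * (a * b) ≡ a * (2 * b)
    swap = solve-∀

module Sums where
  open import Defs using (Σ<)
  open import Data.Nat using (ℕ; zero; suc; _+_; _*_; _≤_)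
  open import Data.Nat.Properties using (+-identityʳ; +-assoc; +-suc; *-zeroʳ; *-distribˡ-+; m≤m+n)
  open import Relation.Binary.PropositionalEquality using (_≡_; refl; sym; trans; cong; cong₂; module ≡-Reasoning)
  open import Data.Nat.Tactic.RingSolver using (solve-∀)
  open ≡-Reasoning

  Σ-cong : ∀ n {f g : ℕ → ℕ} → (∀ k → f k ≡ g k) → Σ< n f ≡ Σ< n g
  Σ-cong zero    f≡g = refl
  Σ-cong (suc n) f≡g = cong₂ _+_ (Σ-cong n f≡g) (f≡g n)

  Σ-distrib-+ : ∀ n (f g : ℕ → ℕ) → Σ< n (λ k → f k + g k) ≡ Σ< n f + Σ< n g
  Σ-distrib-+ zero    f g = refl
  Σ-distrib-+ (suc n) f g =
    trans (cong (_+ (f n + g n)) (Σ-distrib-+ n f g)) (interchange (Σ< n f) (Σ< n g) (f n) (g n))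
    where
    interchange : ∀ a b c d → a + b + (c + d) ≡ a + c + (b + d)
    interchange = solve-∀

  Σ-factor : ∀ n c (f : ℕ → ℕ) → Σ< n (λ k → c * f k) ≡ c * Σ< n f
  Σ-factor zero    c f = sym (*-zeroʳ c)
  Σ-factor (suc n) c f =
    trans (cong (_+ c * f n) (Σ-factor n c f)) (sym (*-distribˡ-+ c (Σ< n f) (f n)))

  Σ-peel : ∀ n (f : ℕ → ℕ) → Σ< (suc n) f ≡ f 0 + Σ< n (λ k → f (suc k))
  Σ-peel zero    f = sym (+-identityʳ (f 0))
  Σ-peel (suc n) f = trans (cong (_+ f (suc n)) (Σ-peel n f)) (+-assoc (f 0) _ _)

  Σ-drop-zero : ∀ n (f : ℕ → ℕ) → f n ≡ 0 → Σ< (suc n) f ≡ Σ< n f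
  Σ-drop-zero n f fn≡0 = trans (cong (Σ< n f +_) fn≡0) (+-identityʳ (Σ< n f))

  Σ-pad : ∀ a d (f : ℕ → ℕ) → (∀ k → a ≤ k → f k ≡ 0) → Σ< (a + d) f ≡ Σ< a f
  Σ-pad a zero    f vanish = cong (λ j → Σ< j f) (+-identityʳ a)
  Σ-pad a (suc d) f vanish = begin
    Σ< (a + suc d) f   ≡⟨ cong (λ j → Σ< j f) (+-suc a d) ⟩
    Σ< (suc (a + d)) f ≡⟨ Σ-drop-zero (a + d) f (vanish (a + d) (m≤m+n a d)) ⟩
    Σ< (a + d) f       ≡⟨ Σ-pad a d f vanish ⟩
    Σ< a f             ∎

module Trinomial where
  open import Defs using (Σ<; Σ≤; T)
  open import Data.Nat using (ℕ; suc; _+_; _*_; _∸_; _/_; _≤_; _<_)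
  open import Data.Nat.Properties
    using (*-suc; *-comm; *-cancelˡ-≡; m≤m+n; m<n⇒m<1+n; m+[n∸m]≡n; ≰⇒>; <⇒≱)
  open import Data.Nat.DivMod using (m/n≤m; m*n/n≡m; /-monoˡ-≤)
  open import Data.Nat.Combinatorics using (_C_; k>n⇒nCk≡0)
  open import Relation.Binary.PropositionalEquality
    using (_≡_; sym; trans; cong; cong₂; subst; module ≡-Reasoning)
  open import Data.Nat.Tactic.RingSolver using (solve-∀)
  open ≡-Reasoning
  open Binomial
  open Sums

  -- Summands of the coefficients of x⁰ and x¹ in (1 + x + x⁻¹)ⁿ: choose the
  -- 2k (resp. 2k+1) factors not contributing 1, then which k of them give x⁻¹.
  B : ℕ → ℕ → ℕ
  B n k = (n C (2 * k)) * (2 * k C k)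

  A : ℕ → ℕ → ℕ
  A n k = (n C suc (2 * k)) * (suc (2 * k) C k)

  T-full : ℕ → ℕ
  T-full n = Σ≤ n (B n)

  E : ℕ → ℕ
  E n = Σ≤ n (A n)

  B-vanishes : ∀ n k → n < 2 * k → B n k ≡ 0
  B-vanishes n k n<2k = cong (_* (2 * k C k)) (k>n⇒nCk≡0 n<2k)

  A-vanishes : ∀ n k → n < suc (2 * k) → A n k ≡ 0
  A-vanishes n k n<2k+1 = cong (_* (suc (2 * k) C k)) (k>n⇒nCk≡0 n<2k+1)

  n<2[n+1] : ∀ n → n < 2 * suc n
  n<2[n+1] n = m≤m+n (suc n) (suc n + 0)

  half-bound : ∀ n k → n / 2 < k → n < 2 * k
  half-bound n k n/2<k = ≰⇒> λ 2k≤n → <⇒≱ n/2<k (k≤n/2 2k≤n)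
    where
    k≤n/2 : 2 * k ≤ n → k ≤ n / 2
    k≤n/2 2k≤n = subst (_≤ n / 2) (m*n/n≡m k 2) (/-monoˡ-≤ 2 (subst (_≤ n) (*-comm 2 k) 2k≤n))

  T≡T-full : ∀ n → T n ≡ T-full n
  T≡T-full n = begin
    Σ< (suc h) (B n)           ≡⟨ Σ-pad (suc h) (n ∸ h) (B n) beyond-half ⟨
    Σ< (suc h + (n ∸ h)) (B n) ≡⟨ cong (λ j → Σ< (suc j) (B n)) (m+[n∸m]≡n (m/n≤m n 2)) ⟩
    Σ< (suc n) (B n)           ∎
    where
    h = n / 2
    beyond-half : ∀ k → suc h ≤ k → B n k ≡ 0
    beyond-half k h<k = B-vanishes n k (half-bound n k h<k)

  B-suc : ∀ n k → B n (suc k) ≡ (n C suc (suc (2 * k))) * (2 * (suc (2 * k) C k))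
  B-suc n k = trans (cong (λ j → (n C j) * (j C suc k)) (*-suc 2 k))
                    (cong ((n C suc (suc (2 * k))) *_) (central-double k))

  B-step : ∀ n k → B (suc n) (suc k) ≡ B n (suc k) + 2 * A n k
  B-step n k = begin
    B (suc n) (suc k)                       ≡⟨ B-suc (suc n) k ⟩
    (suc n C suc (suc (2 * k))) * (2 * c)   ≡⟨ cong (_* (2 * c)) (pascal n (suc (2 * k))) ⟩
    (y + z) * (2 * c)                       ≡⟨ expand y z c ⟩
    z * (2 * c) + 2 * (y * c)               ≡⟨ cong (_+ 2 * A n k) (B-suc n k) ⟨
    B n (suc k) + 2 * A n k                 ∎
    where
    y = n C suc (2 * k)
    z = n C suc (suc (2 * k))
    c = suc (2 * k) C k
    expand : ∀ y z c → (y + z) * (2 * c) ≡ z * (2 * c) + 2 * (y * c)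
    expand = solve-∀

  -- After multiplying by
  -- k+1 both sides become multiples of C(2k,k); the remaining factors agree by
  -- absorption and its complement applied to C(n,2k).
  A-step : ∀ n k → suc (suc n) * A (suc n) k ≡ suc n * (A n k + 2 * B n k)
  A-step n k = *-cancelˡ-≡ _ _ (suc k) (trans lhs (sym rhs))
    where
    X = suc n C suc (2 * k)
    Y = n C suc (2 * k)
    Z = n C (2 * k)
    c = suc (2 * k) C k
    b = 2 * k C k
    lhs : suc k * (suc (suc n) * (X * c)) ≡ suc n * b * (suc (suc n) * Z)
    lhs = begin
      suc k * (suc (suc n) * (X * c))     ≡⟨ move-c n k X c ⟩
      suc (suc n) * X * (suc k * c)       ≡⟨ cong (suc (suc n) * X *_) (central-ratio k) ⟩
      suc (suc n) * X * (suc (2 * k) * b) ≡⟨ move-X n k X b ⟩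
      suc (suc n) * b * (suc (2 * k) * X) ≡⟨ cong (suc (suc n) * b *_) (absorption n (2 * k)) ⟩
      suc (suc n) * b * (suc n * Z)       ≡⟨ move-Z n b Z ⟩
      suc n * b * (suc (suc n) * Z)       ∎
      where
      move-c : ∀ n k X c → suc k * (suc (suc n) * (X * c)) ≡ suc (suc n) * X * (suc k * c)
      move-c = solve-∀
      move-X : ∀ n k X b → suc (suc n) * X * (suc (2 * k) * b) ≡ suc (suc n) * b * (suc (2 * k) * X)
      move-X = solve-∀
      move-Z : ∀ n b Z → suc (suc n) * b * (suc n * Z) ≡ suc n * b * (suc (suc n) * Z)
      move-Z = solve-∀
    rhs : suc k * (suc n * (Y * c + 2 * (Z * b))) ≡ suc n * b * (suc (suc n) * Z)
    rhs = begin
      suc k * (suc n * (Y * c + 2 * (Z * b)))                   ≡⟨ move-c n k Y Z c b ⟩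
      suc n * Y * (suc k * c) + 2 * suc k * suc n * (Z * b)     ≡⟨ cong (λ w → suc n * Y * w + 2 * suc k * suc n * (Z * b)) (central-ratio k) ⟩
      suc n * Y * (suc (2 * k) * b) + 2 * suc k * suc n * (Z * b) ≡⟨ collect n k Y Z b ⟩
      suc n * b * (2 * Z + (2 * k * Z + suc (2 * k) * Y))      ≡⟨ cong (λ w → suc n * b * (2 * Z + w)) (absorption-complement n (2 * k)) ⟨
      suc n * b * (2 * Z + n * Z)                               ≡⟨ cong (suc n * b *_) (finish n Z) ⟩
      suc n * b * (suc (suc n) * Z)                             ∎
      where
      move-c : ∀ n k Y Z c b → suc k * (suc n * (Y * c + 2 * (Z * b))) ≡ suc n * Y * (suc k * c) + 2 * suc k * suc n * (Z * b)
      move-c = solve-∀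
      collect : ∀ n k Y Z b → suc n * Y * (suc (2 * k) * b) + 2 * suc k * suc n * (Z * b) ≡ suc n * b * (2 * Z + (2 * k * Z + suc (2 * k) * Y))
      collect = solve-∀
      finish : ∀ n Z → 2 * Z + n * Z ≡ suc (suc n) * Z
      finish = solve-∀

  T-full-step : ∀ n → T-full (suc n) ≡ T-full n + 2 * E n
  T-full-step n = begin
    T-full (suc n)                                          ≡⟨ Σ-peel (suc n) (B (suc n)) ⟩
    1 + Σ< (suc n) (λ k → B (suc n) (suc k))                ≡⟨ cong (1 +_) (Σ-cong (suc n) (B-step n)) ⟩
    1 + Σ< (suc n) (λ k → B n (suc k) + 2 * A n k)          ≡⟨ cong (1 +_) (Σ-distrib-+ (suc n) (λ k → B n (suc k)) (λ k → 2 * A n k)) ⟩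
    1 + (Σ< (suc n) (λ k → B n (suc k)) + Σ< (suc n) (λ k → 2 * A n k))
      ≡⟨ cong (λ w → 1 + (Σ< (suc n) (λ k → B n (suc k)) + w)) (Σ-factor (suc n) 2 (A n)) ⟩
    1 + (Σ< (suc n) (λ k → B n (suc k)) + 2 * E n)          ≡⟨ cong (_+ 2 * E n) (Σ-peel (suc n) (B n)) ⟨
    Σ< (suc (suc n)) (B n) + 2 * E n                        ≡⟨ cong (_+ 2 * E n) (Σ-drop-zero (suc n) (B n) (B-vanishes n (suc n) (n<2[n+1] n))) ⟩
    T-full n + 2 * E n                                      ∎

  E-step : ∀ n → suc (suc n) * E (suc n) ≡ suc n * (E n + 2 * T-full n)
  E-step n = begin
    suc (suc n) * E (suc n)                                  ≡⟨ Σ-factor (suc (suc n)) (suc (suc n)) (A (suc n)) ⟨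
    Σ< (suc (suc n)) (λ k → suc (suc n) * A (suc n) k)       ≡⟨ Σ-cong (suc (suc n)) (A-step n) ⟩
    Σ< (suc (suc n)) (λ k → suc n * (A n k + 2 * B n k))     ≡⟨ Σ-factor (suc (suc n)) (suc n) (λ k → A n k + 2 * B n k) ⟩
    suc n * Σ< (suc (suc n)) (λ k → A n k + 2 * B n k)       ≡⟨ cong (suc n *_) (Σ-drop-zero (suc n) _ last-vanishes) ⟩
    suc n * Σ< (suc n) (λ k → A n k + 2 * B n k)             ≡⟨ cong (suc n *_) (Σ-distrib-+ (suc n) (A n) (λ k → 2 * B n k)) ⟩
    suc n * (E n + Σ< (suc n) (λ k → 2 * B n k))             ≡⟨ cong (λ w → suc n * (E n + w)) (Σ-factor (suc n) 2 (B n)) ⟩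
    suc n * (E n + 2 * T-full n)                             ∎
    where
    last-vanishes : A n (suc n) + 2 * B n (suc n) ≡ 0
    last-vanishes = cong₂ (λ a b → a + 2 * b) (A-vanishes n (suc n) (m<n⇒m<1+n (n<2[n+1] n))) (B-vanishes n (suc n) (n<2[n+1] n))

  T-recurrence : ∀ n → T (suc n) ≡ T n + 2 * E n
  T-recurrence n = begin
    T (suc n)          ≡⟨ T≡T-full (suc n) ⟩
    T-full (suc n)     ≡⟨ T-full-step n ⟩
    T-full n + 2 * E n ≡⟨ cong (_+ 2 * E n) (T≡T-full n) ⟨
    T n + 2 * E n      ∎

  E-recurrence : ∀ n → suc (suc n) * E (suc n) ≡ suc n * (E n + 2 * T n)
  E-recurrence n = trans (E-step n) (cong (λ t → suc n * (E n + 2 * t)) (sym (T≡T-full n)))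

module Divisor where
  open import Data.Nat using (ℕ; suc; _+_; _*_; _∸_; _/_)
  open import Data.Nat.Properties using (*-comm)
  open import Data.Nat.DivMod using (m*n/n≡m)
  open import Data.Nat.Combinatorics using (_C_)
  open import Relation.Binary.PropositionalEquality using (_≡_; sym; trans; cong; module ≡-Reasoning)
  open import Data.Nat.Tactic.RingSolver using (solve-∀)
  open ≡-Reasoning
  open Binomial using (six-choose-three)

  -- For n = m+1, the number n·C(n+1,3), which is n²(n²−1)/6.
  sixth : ℕ → ℕ
  sixth m = suc m * (suc (suc m) C 3)

  six-sixth : ∀ m → 6 * sixth m ≡ suc m * (suc (suc m) * (suc m * m))
  six-sixth m = trans (swap (suc m) (suc (suc m) C 3)) (cong (suc m *_) (six-choose-three m))
    where
    swap : ∀ a b → 6 * (a * b) ≡ a * (6 * b)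
    swap = solve-∀

  divisor≡sixth : ∀ m → suc m * suc m * (suc m * suc m ∸ 1) / 6 ≡ sixth m
  divisor≡sixth m = begin
    suc m * suc m * (m + m * suc m) / 6 ≡⟨ cong (_/ 6) divisor≡6*sixth ⟩
    sixth m * 6 / 6                     ≡⟨ m*n/n≡m (sixth m) 6 ⟩
    sixth m                             ∎
    where
    arrange : ∀ m → suc m * (suc (suc m) * (suc m * m)) ≡ suc m * suc m * (m + m * suc m)
    arrange = solve-∀
    divisor≡6*sixth : suc m * suc m * (m + m * suc m) ≡ sixth m * 6
    divisor≡6*sixth = trans (sym (arrange m)) (trans (sym (six-sixth m)) (*-comm 6 (sixth m)))

module ClosedForm where
  open import Defs using (Σ<; T)
  open import Data.Nat using (ℕ; zero; suc)
  import Data.Nat as ℕ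
  import Data.Nat.Properties as ℕₚ
  open import Data.Nat.Divisibility using (divides) renaming (_∣_ to _∣ℕ_)
  open import Data.Integer using (ℤ; +_; _+_; _*_; _-_; -_; 0ℤ; ∣_∣)
  open import Data.Integer.Properties
    using (pos-+; pos-*; *-assoc; *-cancelˡ-≡; i≡j⇒i-j≡0; i-j≡0⇒i≡j; abs-*)
  open import Relation.Binary.PropositionalEquality using (_≡_; refl; sym; trans; cong; cong₂; module ≡-Reasoning)
  open import Data.Integer.Tactic.RingSolver using (solve-∀)
  open ≡-Reasoning
  open Trinomial using (E; T-recurrence; E-recurrence)
  open Divisor using (sixth; six-sixth)

  t e : ℕ → ℤ
  t n = + T n
  e n = + E n

  t-step : ∀ n → t (suc n) ≡ t n + + 2 * e n
  t-step n = begin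
    + T (suc n)             ≡⟨ cong +_ (T-recurrence n) ⟩
    + (T n ℕ.+ 2 ℕ.* E n)   ≡⟨ pos-+ (T n) (2 ℕ.* E n) ⟩
    t n + + (2 ℕ.* E n)     ≡⟨ cong (λ y → t n + y) (pos-* 2 (E n)) ⟩
    t n + + 2 * e n         ∎

  e-step : ∀ n → (+ 2 + + n) * e (suc n) ≡ (+ 1 + + n) * (e n + + 2 * t n)
  e-step n = begin
    + suc (suc n) * + E (suc n)       ≡⟨ pos-* (suc (suc n)) (E (suc n)) ⟨
    + (suc (suc n) ℕ.* E (suc n))     ≡⟨ cong +_ (E-recurrence n) ⟩
    + (suc n ℕ.* (E n ℕ.+ 2 ℕ.* T n)) ≡⟨ pos-* (suc n) (E n ℕ.+ 2 ℕ.* T n) ⟩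
    + suc n * + (E n ℕ.+ 2 ℕ.* T n)   ≡⟨ cong (+ suc n *_) (trans (pos-+ (E n) (2 ℕ.* T n)) (cong (λ y → e n + y) (pos-* 2 (T n)))) ⟩
    + suc n * (e n + + 2 * t n)       ∎

  -- u n = E n / n, defined without division; e≡n*u shows the division is exact.
  u : ℕ → ℤ
  u zero    = 0ℤ
  u (suc n) = e n + + 2 * t n - e (suc n)

  e≡n*u : ∀ n → e n ≡ + n * u n
  e≡n*u zero    = refl
  e≡n*u (suc n) = sym (begin
    (+ 1 + + n) * (x - e (suc n))                         ≡⟨ expand (+ n) x (e (suc n)) ⟩
    (+ 1 + + n) * x - (+ 2 + + n) * e (suc n) + e (suc n) ≡⟨ cong (λ y → (+ 1 + + n) * x - y + e (suc n)) (e-step n) ⟩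
    (+ 1 + + n) * x - (+ 1 + + n) * x + e (suc n)         ≡⟨ cancel ((+ 1 + + n) * x) (e (suc n)) ⟩
    e (suc n)                                             ∎)
    where
    x = e n + + 2 * t n
    expand : ∀ a x y → (+ 1 + a) * (x - y) ≡ (+ 1 + a) * x - (+ 2 + a) * y + y
    expand = solve-∀
    cancel : ∀ z y → z - z + y ≡ y
    cancel = solve-∀

  t-rec : ∀ n → t (suc n) ≡ t n + + 2 * + n * u n
  t-rec n = begin
    t (suc n)               ≡⟨ t-step n ⟩
    t n + + 2 * e n         ≡⟨ cong (λ y → t n + + 2 * y) (e≡n*u n) ⟩
    t n + + 2 * (+ n * u n) ≡⟨ cong (λ y → t n + y) (*-assoc (+ 2) (+ n) (u n)) ⟨
    t n + + 2 * + n * u n   ∎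

  u-rec : ∀ n → (+ 2 + + n) * u (suc n) ≡ + n * u n + + 2 * t n
  u-rec n = begin
    (+ 2 + + n) * (x - e (suc n))                     ≡⟨ expand (+ n) x (e (suc n)) ⟩
    (+ 1 + + n) * x + x - (+ 2 + + n) * e (suc n)     ≡⟨ cong (λ y → (+ 1 + + n) * x + x - y) (e-step n) ⟩
    (+ 1 + + n) * x + x - (+ 1 + + n) * x             ≡⟨ cancel ((+ 1 + + n) * x) x ⟩
    x                                                 ≡⟨ cong (_+ + 2 * t n) (e≡n*u n) ⟩
    + n * u n + + 2 * t n                             ∎
    where
    x = e n + + 2 * t n
    expand : ∀ a x y → (+ 2 + a) * (x - y) ≡ (+ 1 + a) * x + x - (+ 2 + a) * y
    expand = solve-∀
    cancel : ∀ z x → z + x - z ≡ x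
    cancel = solve-∀

  -- 2·T (n+1) = 3n·u n + (n+2)·u (n+1): the relation that eliminates u (n−1).
  two-t-rec : ∀ n → + 2 * t (suc n) ≡ + 3 * + n * u n + (+ 2 + + n) * u (suc n)
  two-t-rec n = begin
    + 2 * t (suc n)                             ≡⟨ cong (+ 2 *_) (t-rec n) ⟩
    + 2 * (t n + + 2 * + n * u n)               ≡⟨ regroup (t n) (+ n) (u n) ⟩
    + 3 * + n * u n + (+ n * u n + + 2 * t n)   ≡⟨ cong (λ y → + 3 * + n * u n + y) (u-rec n) ⟨
    + 3 * + n * u n + (+ 2 + + n) * u (suc n)   ∎
    where
    regroup : ∀ x a b → + 2 * (x + + 2 * a * b) ≡ + 3 * a * b + (a * b + + 2 * x)
    regroup = solve-∀

  -- Δ n = n²(n²−1), the weight K k = k(k+1)(8k+9) of the summand, and the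
  -- quadratic form Q of the closed form 6·S n = Δ n · Q (n, T n, u (n−1), u n).
  Δ : ℤ → ℤ
  Δ n = n * n * (n * n - + 1)

  K : ℤ → ℤ
  K n = n * (n + + 1) * (+ 8 * n + + 9)

  Q : ℤ → ℤ → ℤ → ℤ → ℤ
  Q n t p q = - ((+ 2 * n - + 29) * t * q) - + 3 * (+ 2 * n - + 1) * t * p
              + + 3 * ((+ 2 * n - + 3) * (+ 2 * n - + 3)) * p * q

  -- The inductive step as a polynomial identity in n = m+1: the difference of the
  -- two sides of the new closed form (scaled by n+2) is a combination of the old
  -- closed form and the two linear recurrences, with cofactors W and V.  Δ, K, Q
  -- are restated locally because the ring solver does not unfold definitions.
  step-identity : ∀ m t p q r S →
    let Δ = λ n → n * n * (n * n - + 1)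
        K = λ n → n * (n + + 1) * (+ 8 * n + + 9)
        Q = λ n t p q → - ((+ 2 * n - + 29) * t * q) - + 3 * (+ 2 * n - + 1) * t * p
                          + + 3 * ((+ 2 * n - + 3) * (+ 2 * n - + 3)) * p * q
        n = + 1 + m
        t′ = t + + 2 * n * q
        W = - ((+ 2 * n - + 1) * t) + (+ 2 * n - + 3) * (+ 2 * n - + 3) * q
        V = - ((+ 2 * n - + 27) * t′) + + 3 * ((+ 2 * n - + 1) * (+ 2 * n - + 1)) * q
    in (+ 3 + m) * (+ 6 * (S + K n * t * t′)) - (+ 3 + m) * (Δ (+ 2 + m) * Q (+ 2 + m) t′ q r)
       ≡ (+ 3 + m) * (+ 6 * S - Δ n * Q n t p q)
         + (+ 3 + m) * n * n * (+ 2 + m) * W * (+ 3 * m * p + (+ 2 + m) * q - + 2 * t)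
         - Δ (+ 2 + m) * V * ((+ 3 + m) * r - ((+ 1 + m) * q + + 2 * t))
  step-identity = solve-∀

  combination-of-zeros : ∀ a b c {x y z} → x ≡ 0ℤ → y ≡ 0ℤ → z ≡ 0ℤ → a * x + b * y - c * z ≡ 0ℤ
  combination-of-zeros a b c refl refl refl = vanish a b c
    where
    vanish : ∀ a b c → a * 0ℤ + b * 0ℤ - c * 0ℤ ≡ 0ℤ
    vanish = solve-∀

  closed-form-step : ∀ (m : ℕ) t p q r S →
    + 2 * t ≡ + 3 * + m * p + (+ 2 + + m) * q →
    (+ 3 + + m) * r ≡ (+ 1 + + m) * q + + 2 * t →
    + 6 * S ≡ Δ (+ 1 + + m) * Q (+ 1 + + m) t p q →
    + 6 * (S + K (+ 1 + + m) * t * (t + + 2 * (+ 1 + + m) * q))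
      ≡ Δ (+ 2 + + m) * Q (+ 2 + + m) (t + + 2 * (+ 1 + + m) * q) q r
  closed-form-step m t p q r S t-rel r-rel closed =
    *-cancelˡ-≡ (+ 3 + + m) _ _ (i-j≡0⇒i≡j _ _ (trans (step-identity (+ m) t p q r S)
      (combination-of-zeros (+ 3 + + m) ((+ 3 + + m) * n * n * (+ 2 + + m) * W) (Δ (+ 2 + + m) * V)
        (i≡j⇒i-j≡0 closed) (i≡j⇒i-j≡0 (sym t-rel)) (i≡j⇒i-j≡0 r-rel))))
    where
    n = + 1 + + m
    W = - ((+ 2 * n - + 1) * t) + (+ 2 * n - + 3) * (+ 2 * n - + 3) * q
    V = - ((+ 2 * n - + 27) * (t + + 2 * n * q)) + + 3 * ((+ 2 * n - + 1) * (+ 2 * n - + 1)) * q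

  summand : ℕ → ℕ
  summand k = k ℕ.* (k ℕ.+ 1) ℕ.* (8 ℕ.* k ℕ.+ 9) ℕ.* T k ℕ.* T (k ℕ.+ 1)

  S : ℕ → ℕ
  S n = Σ< n summand

  summand-cast : ∀ k → + summand k ≡ K (+ k) * t k * t (suc k)
  summand-cast k = begin
    + (w ℕ.* T k ℕ.* T (k ℕ.+ 1))     ≡⟨ pos-* (w ℕ.* T k) (T (k ℕ.+ 1)) ⟩
    + (w ℕ.* T k) * + T (k ℕ.+ 1)     ≡⟨ cong₂ _*_ (trans (pos-* w (T k)) (cong (_* t k) weight-cast))
                                                   (cong t (ℕₚ.+-comm k 1)) ⟩
    K (+ k) * t k * t (suc k)         ∎
    where
    w = k ℕ.* (k ℕ.+ 1) ℕ.* (8 ℕ.* k ℕ.+ 9)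
    weight-cast : + w ≡ K (+ k)
    weight-cast = begin
      + w                                       ≡⟨ pos-* (k ℕ.* (k ℕ.+ 1)) (8 ℕ.* k ℕ.+ 9) ⟩
      + (k ℕ.* (k ℕ.+ 1)) * + (8 ℕ.* k ℕ.+ 9)   ≡⟨ cong₂ _*_ (trans (pos-* k (k ℕ.+ 1)) (cong (+ k *_) (pos-+ k 1)))
                                                             (trans (pos-+ (8 ℕ.* k) 9) (cong (_+ + 9) (pos-* 8 k))) ⟩
      K (+ k)                                   ∎

  closed-form : ∀ m → + 6 * + S (suc m) ≡ Δ (+ suc m) * Q (+ suc m) (t (suc m)) (u m) (u (suc m))
  closed-form zero    = refl
  closed-form (suc m) = begin
    + 6 * + (S (suc m) ℕ.+ summand (suc m))
      ≡⟨ cong (+ 6 *_) (trans (pos-+ (S (suc m)) (summand (suc m))) (cong (λ y → + S (suc m) + y) (summand-cast (suc m)))) ⟩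
    + 6 * (+ S (suc m) + K (+ suc m) * t (suc m) * t (suc (suc m)))
      ≡⟨ cong (λ y → + 6 * (+ S (suc m) + K (+ suc m) * t (suc m) * y)) (t-rec (suc m)) ⟩
    + 6 * (+ S (suc m) + K (+ suc m) * t (suc m) * t′)
      ≡⟨ closed-form-step m (t (suc m)) (u m) (u (suc m)) (u (suc (suc m))) (+ S (suc m))
           (two-t-rec m) (u-rec (suc m)) (closed-form m) ⟩
    Δ (+ suc (suc m)) * Q (+ suc (suc m)) t′ (u (suc m)) (u (suc (suc m)))
      ≡⟨ cong (λ y → Δ (+ suc (suc m)) * Q (+ suc (suc m)) y (u (suc m)) (u (suc (suc m)))) (t-rec (suc m)) ⟨
    Δ (+ suc (suc m)) * Q (+ suc (suc m)) (t (suc (suc m))) (u (suc m)) (u (suc (suc m))) ∎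
    where
    t′ = t (suc m) + + 2 * + suc m * u (suc m)

  Δ≡6*sixth : ∀ m → Δ (+ suc m) ≡ + 6 * + sixth m
  Δ≡6*sixth m = begin
    Δ (+ 1 + + m)                                  ≡⟨ factor (+ m) ⟨
    (+ 1 + + m) * ((+ 2 + + m) * ((+ 1 + + m) * + m)) ≡⟨ cast ⟨
    + (suc m ℕ.* (suc (suc m) ℕ.* (suc m ℕ.* m)))  ≡⟨ cong +_ (six-sixth m) ⟨
    + (6 ℕ.* sixth m)                              ≡⟨ pos-* 6 (sixth m) ⟩
    + 6 * + sixth m                                ∎
    where
    factor : ∀ a → (+ 1 + a) * ((+ 2 + a) * ((+ 1 + a) * a))
                   ≡ (+ 1 + a) * (+ 1 + a) * ((+ 1 + a) * (+ 1 + a) - + 1)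
    factor = solve-∀
    cast : + (suc m ℕ.* (suc (suc m) ℕ.* (suc m ℕ.* m))) ≡ + suc m * (+ suc (suc m) * (+ suc m * + m))
    cast = trans (pos-* (suc m) (suc (suc m) ℕ.* (suc m ℕ.* m)))
                 (cong (+ suc m *_) (trans (pos-* (suc (suc m)) (suc m ℕ.* m))
                                           (cong (+ suc (suc m) *_) (pos-* (suc m) m))))

  divides-via-ℤ : ∀ {g s} (q : ℤ) → + s ≡ + g * q → g ∣ℕ s
  divides-via-ℤ {g} q s≡gq = divides ∣ q ∣ (trans (cong ∣_∣ s≡gq) (trans (abs-* (+ g) q) (ℕₚ.*-comm g ∣ q ∣)))

  sixth-divides-S : ∀ m → sixth m ∣ℕ S (suc m)
  sixth-divides-S m = divides-via-ℤ q (*-cancelˡ-≡ (+ 6) _ _ (begin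
    + 6 * + S (suc m)      ≡⟨ closed-form m ⟩
    Δ (+ suc m) * q        ≡⟨ cong (_* q) (Δ≡6*sixth m) ⟩
    + 6 * + sixth m * q    ≡⟨ *-assoc (+ 6) (+ sixth m) q ⟩
    + 6 * (+ sixth m * q)  ∎))
    where
    q = Q (+ suc m) (t (suc m)) (u m) (u (suc m))

open import Defs
open import Data.Nat using (ℕ; suc; _+_; _*_; _∸_; _/_; NonZero)
open import Data.Nat.Divisibility using (_∣_)
open import Relation.Binary.PropositionalEquality using (sym; subst)
open Divisor using (divisor≡sixth)
open ClosedForm using (S; sixth-divides-S)

theorem1p2 : (n : ℕ) → .{{_ : NonZero n}} →
    ((n * n * (n * n ∸ 1)) / 6) ∣ Σ< n (λ k → k * (k + 1) * (8 * k + 9) * T k * T (k + 1))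
theorem1p2 (suc m) = subst (_∣ S (suc m)) (sym (divisor≡sixth m)) (sixth-divides-S m)
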